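{- Let $F$ be an undirected graph with $k$ vertices and $\ell$ edges, and let $\vec H$ be a digraph with $\alpha_s(\vec H)\ge k+\ell$. Then there exists an arc supergraph $\vec H'$ of $\vec H$ such that the directed split $\overrightarrow{F}$ of $F$ is a monotone reversible minor of $\vec H'$.
   Context: Digraphs are finite, no multiple arcs, loops allowed. $\alpha_s(\vec H)$ is the number of sources (indegree-$0$ vertices) of the DAG $\vec H/\!\sim$ obtained by contracting each strongly connected component (SCC) of $\vec H$ to a vertex and deleting loops. $\vec H'$ is an arc supergraph of $\vec H$ if $V(\vec H')=V(\vec H)$ and $E(\vec H)\subseteq E(\vec H')$. The directed split of an undirected graph $F$ is the $1$-subdivision of $F$ with every edge oriented towards the original vertex of $F$. MR minor operations: delete all vertices of an SCC that is a sink of $\vec H/\!\sim$; contract an arc $(u,v)$ by identifying $u$ and $v$ (no loop arises from this arc); delete a loop; an MR minor is the result of a finite sequence of such operations. -}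

module Defs where

open import Data.Nat using (ℕ; _+_; _<_)
open import Data.Fin using (Fin; toℕ; splitAt; cast)
open import Data.Fin.Properties using () renaming (_≟_ to _≟F_)
open import Data.Bool using (Bool; true; false; _∨_)
open import Data.Product using (Σ; ∃; _×_; _,_; proj₁; proj₂)
open import Data.Sum using (_⊎_; inj₁; inj₂)
open import Relation.Nullary using (¬_; does)
open import Relation.Binary.PropositionalEquality using (_≡_)
open import Function.Bundles using (_⇔_; _↔_; Inverse)
open import Function.Definitions using (Injective)

-- Digraphs: finite vertex set Fin n, at most one arc per ordered pair,
-- loops allowed.

record Digraph : Set where
  field
    n   : ℕ
    arc : Fin n → Fin n → Bool

open Digraph public

E : (G : Digraph) → Fin (n G) → Fin (n G) → Set
E G u v = arc G u v ≡ true

data Reach (G : Digraph) : Fin (n G) → Fin (n G) → Set where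
  here : ∀ {u} → Reach G u u
  step : ∀ {u w v} → E G u w → Reach G w v → Reach G u v

SameSCC : (G : Digraph) → Fin (n G) → Fin (n G) → Set
SameSCC G u v = Reach G u v × Reach G v u

-- the SCC of v is a source of the condensation G/~ (no arc enters it
-- from another SCC)
SourceSCC : (G : Digraph) → Fin (n G) → Set
SourceSCC G v = ∀ u w → E G u w → SameSCC G w v → SameSCC G u v

-- the SCC of v is a sink of the condensation G/~ (no arc leaves it)
SinkSCC : (G : Digraph) → Fin (n G) → Set
SinkSCC G v = ∀ u w → E G u w → SameSCC G u v → SameSCC G w v

-- α_s(G) ≥ m : G/~ has at least m sources, i.e. there are m vertices
-- lying in pairwise distinct source SCCs.
αs≥ : Digraph → ℕ → Set
αs≥ G m = Σ (Fin m → Fin (n G)) λ f →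
            (∀ i j → SameSCC G (f i) (f j) → i ≡ j) × (∀ i → SourceSCC G (f i))

record ArcSupergraph (G : Digraph) : Set where
  field
    arc′   : Fin (n G) → Fin (n G) → Bool
    superset : ∀ u v → E G u v → arc′ u v ≡ true

  graph : Digraph
  graph = record { n = n G ; arc = arc′ }

data MRStep (G G' : Digraph) : Set where
  -- delete all vertices of a sink SCC (the SCC of v); G' is the induced
  -- subgraph on the remaining vertices, given via an embedding ι whose
  -- image is exactly the set of vertices outside the SCC of v.
  deleteSink : (v : Fin (n G)) → SinkSCC G v →
               (ι : Fin (n G') → Fin (n G)) → Injective _≡_ _≡_ ι →
               (∀ x → ¬ SameSCC G (ι x) v) →
               (∀ u → ¬ SameSCC G u v → ∃ λ x → ι x ≡ u) →
               (∀ a b → arc G' a b ≡ arc G (ι a) (ι b)) →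
               MRStep G G'
  -- contract the arc (u , v) (u ≠ v): π identifies exactly u and v; the
  -- arcs of G' are the images of the arcs of G other than (u , v) itself
  -- (so no loop arises from this arc).
  contract   : (u v : Fin (n G)) → E G u v → ¬ u ≡ v →
               (π : Fin (n G) → Fin (n G')) →
               (∀ a → ∃ λ x → π x ≡ a) →
               (∀ x y → π x ≡ π y ⇔ (x ≡ y ⊎ ((x ≡ u × y ≡ v) ⊎ (x ≡ v × y ≡ u)))) →
               (∀ a b → E G' a b ⇔
                  (∃ λ x → ∃ λ y → π x ≡ a × π y ≡ b × E G x y × ¬ (x ≡ u × y ≡ v))) →
               MRStep G G'
  deleteLoop : (w : Fin (n G)) → E G w w →
               (eq : n G' ≡ n G) →
               (∀ a b → E G' a b ⇔ (E G (cast eq a) (cast eq b) × ¬ (cast eq a ≡ w × cast eq b ≡ w))) →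
               MRStep G G'

data MRMinorSeq : Digraph → Digraph → Set where
  done : ∀ {G} → MRMinorSeq G G
  _∷_  : ∀ {G G' G''} → MRStep G G' → MRMinorSeq G' G'' → MRMinorSeq G G''

_≅_ : Digraph → Digraph → Set
G ≅ G' = Σ (Fin (n G) ↔ Fin (n G')) λ φ →
           ∀ a b → arc G' (Inverse.to φ a) (Inverse.to φ b) ≡ arc G a b

MRMinor : (G F : Digraph) → Set
MRMinor G F = ∃ λ G' → MRMinorSeq G G' × (G' ≅ F)

-- Finite simple undirected graphs with k vertices and ℓ edges: edge e
-- is {p₁ e , p₂ e} with p₁ e < p₂ e (no loops), distinct edges are
-- distinct pairs (no multiple edges).

record UGraph (k ℓ : ℕ) : Set where
  field
    end₁ end₂ : Fin ℓ → Fin k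
    canonical : ∀ e → toℕ (end₁ e) < toℕ (end₂ e)
    simple    : ∀ e f → end₁ e ≡ end₁ f → end₂ e ≡ end₂ f → e ≡ f

open UGraph public

-- directed split of F: vertices Fin (k + ℓ); the first k are the original
-- vertices, the last ℓ the subdivision vertices; arcs go from the
-- subdivision vertex of e to both ends of e.
directedSplit : ∀ {k ℓ} → UGraph k ℓ → Digraph
directedSplit {k} {ℓ} F = record { n = k + ℓ ; arc = a }
  where
  a : Fin (k + ℓ) → Fin (k + ℓ) → Bool
  a p q with splitAt k p | splitAt k q
  ... | inj₂ e | inj₁ x = does (end₁ F e ≟F x) ∨ does (end₂ F e ≟F x)
  ... | _      | _      = false

{-# OPTIONS --safe #-}
-- Let f pick one vertex in each of k + ℓ distinct source SCCs of H. Add arcs so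
-- that the SCC of f i becomes a complete looped block Bᵢ, the blocks are joined
-- exactly along the arcs of the directed split, and all remaining vertices form
-- one complete sink class entered from every block. An arc of H entering a
-- source SCC starts inside it, so H is contained in this digraph. Deleting the
-- sink class, contracting every block to a single vertex and finally deleting
-- the loops leaves the directed split.
module Submission where

open import Defs
open import Data.Nat using (ℕ; zero; suc; _+_; _<_)
open import Data.Nat.Properties using (≤∧≢⇒<; ≤-pred; m≤n⇒m≤1+n; n<1+n) renaming (_≟_ to _≟ℕ_)
open import Data.Fin using (Fin; zero; suc; toℕ; splitAt; cast; punchIn; punchOut; lift)
open import Data.Fin.Properties
  using (any?; all?; ¬∀⟶∃¬; toℕ<n; toℕ-injective; cast-is-id; lift-injective;
         punchIn-injective; punchInᵢ≢i; punchIn-punchOut; suc-injective)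
  renaming (_≟_ to _≟F_)
open import Data.Bool using (Bool; true; false; _∧_; _∨_; not) renaming (_≟_ to _≟B_)
open import Data.Maybe using (Maybe; just; nothing)
open import Data.Maybe.Properties using (just-injective)
open import Data.Product using (Σ; Σ-syntax; ∃; ∃-syntax; _×_; _,_; proj₁; proj₂)
open import Data.Sum using (_⊎_; inj₁; inj₂; [_,_]′)
open import Relation.Nullary using (¬_; Dec; yes; no; does; contradiction)
open import Relation.Nullary.Decidable using (_×-dec_; _⊎-dec_; ¬?; map′)
open import Relation.Unary using (Pred; Decidable)
open import Relation.Binary.PropositionalEquality
open import Function using (_∘_; id)
open import Function.Bundles using (_⇔_; mk⇔; mk⤖; Equivalence)
open import Function.Definitions using (Injective; StrictlySurjective)
open import Function.Consequences.Propositional using (strictlySurjective⇒surjective)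
open import Function.Properties.Bijection using (⤖⇒↔)

digraph : (m : ℕ) → (Fin m → Fin m → Bool) → Digraph
digraph m A = record { n = m ; arc = A }

Reach-trans : ∀ {G u v w} → Reach G u v → Reach G v w → Reach G u w
Reach-trans here       q = q
Reach-trans (step e p) q = step e (Reach-trans p q)

module Walks (G : Digraph) where

  -- Floyd–Warshall: walks from u to v whose inner vertices all have index below k.
  data Walk (k : ℕ) : Fin (n G) → Fin (n G) → Set where
    nil  : ∀ {u} → Walk k u u
    edge : ∀ {u v} → E G u v → Walk k u v
    cons : ∀ {u w v} → E G u w → toℕ w < k → Walk k w v → Walk k u v

  Walk-suc : ∀ {k u v} → Walk k u v → Walk (suc k) u v
  Walk-suc nil          = nil
  Walk-suc (edge e)     = edge e
  Walk-suc (cons e w r) = cons e (m≤n⇒m≤1+n w) (Walk-suc r)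

  Walk-via : ∀ {k u x v} → Walk k u x → toℕ x < k → Walk k x v → Walk k u v
  Walk-via nil          x<k q = q
  Walk-via (edge e)     x<k q = cons e x<k q
  Walk-via (cons e w r) x<k q = cons e w (Walk-via r x<k q)

  Walk-split : ∀ {k u v} → Walk (suc k) u v →
               Walk k u v ⊎ ∃[ x ] (toℕ x ≡ k × Walk k u x × Walk k x v)
  Walk-split nil      = inj₁ nil
  Walk-split (edge e) = inj₁ (edge e)
  Walk-split {k} (cons {w = w} e w<1+k r) with Walk-split r | toℕ w ≟ℕ k
  ... | inj₁ r′ | yes w≡k = inj₂ (w , w≡k , edge e , r′)
  ... | inj₁ r′ | no  w≢k = inj₁ (cons e (≤∧≢⇒< (≤-pred w<1+k) w≢k) r′)
  ... | inj₂ (x , x≡k , p , q) | no  w≢k =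
    inj₂ (x , x≡k , cons e (≤∧≢⇒< (≤-pred w<1+k) w≢k) p , q)
  ... | inj₂ (x , x≡k , p , q) | yes w≡k with toℕ-injective {i = x} {j = w} (trans x≡k (sym w≡k))
  ...   | refl = inj₂ (x , x≡k , edge e , q)

  Walk-zero : ∀ {u v} → Walk zero u v → u ≡ v ⊎ E G u v
  Walk-zero nil      = inj₁ refl
  Walk-zero (edge e) = inj₂ e

  Walk? : ∀ k u v → Dec (Walk k u v)
  Walk? zero u v = map′ [ (λ { refl → nil }) , edge ]′ Walk-zero ((u ≟F v) ⊎-dec (arc G u v ≟B true))
  Walk? (suc k) u v = map′ [ Walk-suc , via ]′ Walk-split
    (Walk? k u v ⊎-dec any? (λ x → (toℕ x ≟ℕ k) ×-dec Walk? k u x ×-dec Walk? k x v))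
    where
    via : ∃[ x ] (toℕ x ≡ k × Walk k u x × Walk k x v) → Walk (suc k) u v
    via (x , refl , p , q) = Walk-via (Walk-suc p) (n<1+n (toℕ x)) (Walk-suc q)

  Reach⇒Walk : ∀ {u v} → Reach G u v → Walk (n G) u v
  Reach⇒Walk here                 = nil
  Reach⇒Walk (step {w = w} e r) = cons e (toℕ<n w) (Reach⇒Walk r)

  Walk⇒Reach : ∀ {k u v} → Walk k u v → Reach G u v
  Walk⇒Reach nil          = here
  Walk⇒Reach (edge e)     = step e here
  Walk⇒Reach (cons e _ r) = step e (Walk⇒Reach r)

  Reach? : ∀ u v → Dec (Reach G u v)
  Reach? u v = map′ Walk⇒Reach Reach⇒Walk (Walk? (n G) u v)

  SameSCC? : ∀ u v → Dec (SameSCC G u v)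
  SameSCC? u v = Reach? u v ×-dec Reach? v u

record Enumeration {m : ℕ} (P : Pred (Fin m) _) : Set where
  field
    size     : ℕ
    index    : Fin size → Fin m
    index-injective : Injective _≡_ _≡_ index
    index-sound     : ∀ z → P (index z)
    index-complete  : ∀ u → P u → ∃[ z ] index z ≡ u

enumerate : ∀ {m} {P : Pred (Fin m) _} → Decidable P → Enumeration P
enumerate {zero} _ = record
  { size = zero ; index = λ () ; index-injective = λ { {()} } ; index-sound = λ () ; index-complete = λ () }
enumerate {suc m} P? with enumerate (P? ∘ suc) | P? zero
... | Eₛ | yes p0 = record
  { size = suc size ; index = lift 1 index ; index-injective = lift-injective index index-injective 1
  ; index-sound = λ { zero → p0 ; (suc z) → index-sound z }
  ; index-complete = λ { zero _ → zero , refl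
                       ; (suc u) pu → let z , eq = index-complete u pu in suc z , cong suc eq } }
  where open Enumeration Eₛ
... | Eₛ | no ¬p0 = record
  { size = size ; index = suc ∘ index ; index-injective = index-injective ∘ suc-injective
  ; index-sound = index-sound
  ; index-complete = λ { zero p0 → contradiction p0 ¬p0
                       ; (suc u) pu → let z , eq = index-complete u pu in z , cong suc eq } }
  where open Enumeration Eₛ

module Merge {m} {a c : Fin (suc m)} (a≢c : a ≢ c) where

  redirect : Fin (suc m) → Fin (suc m)
  redirect x with x ≟F c
  ... | yes _ = a
  ... | no  _ = x

  c≢redirect : ∀ x → c ≢ redirect x
  c≢redirect x with x ≟F c
  ... | yes _   = a≢c ∘ sym
  ... | no  x≢c = x≢c ∘ sym

  redirect-≢ : ∀ {x} → x ≢ c → redirect x ≡ x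
  redirect-≢ {x} x≢c with x ≟F c
  ... | yes x≡c = contradiction x≡c x≢c
  ... | no  _   = refl

  redirect-≡ : ∀ x y → redirect x ≡ redirect y ⇔ (x ≡ y ⊎ (x ≡ a × y ≡ c) ⊎ (x ≡ c × y ≡ a))
  redirect-≡ x y with x ≟F c | y ≟F c
  ... | yes x≡c | yes y≡c = mk⇔ (λ _ → inj₁ (trans x≡c (sym y≡c))) (λ _ → refl)
  ... | yes x≡c | no  y≢c = mk⇔ (λ a≡y → inj₂ (inj₂ (x≡c , sym a≡y)))
    λ { (inj₁ refl) → contradiction x≡c y≢c ; (inj₂ (inj₁ (_ , y≡c))) → contradiction y≡c y≢c
      ; (inj₂ (inj₂ (_ , y≡a))) → sym y≡a }
  ... | no  x≢c | yes y≡c = mk⇔ (λ x≡a → inj₂ (inj₁ (x≡a , y≡c)))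
    λ { (inj₁ refl) → contradiction y≡c x≢c ; (inj₂ (inj₁ (x≡a , _))) → x≡a
      ; (inj₂ (inj₂ (x≡c , _))) → contradiction x≡c x≢c }
  ... | no  x≢c | no  y≢c = mk⇔ inj₁
    λ { (inj₁ x≡y) → x≡y ; (inj₂ (inj₁ (_ , y≡c))) → contradiction y≡c y≢c
      ; (inj₂ (inj₂ (x≡c , _))) → contradiction x≡c x≢c }

  merge : Fin (suc m) → Fin m
  merge x = punchOut (c≢redirect x)

  punchIn-merge : ∀ x → punchIn c (merge x) ≡ redirect x
  punchIn-merge x = punchIn-punchOut (c≢redirect x)

  merge-punchIn : ∀ p → merge (punchIn c p) ≡ p
  merge-punchIn p = punchIn-injective c _ _
    (trans (punchIn-merge (punchIn c p)) (redirect-≢ (punchInᵢ≢i c p)))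

  merge-≡ : ∀ x y → merge x ≡ merge y ⇔ (x ≡ y ⊎ (x ≡ a × y ≡ c) ⊎ (x ≡ c × y ≡ a))
  merge-≡ x y = mk⇔
    (λ eq → Equivalence.to (redirect-≡ x y)
              (trans (sym (punchIn-merge x)) (trans (cong (punchIn c) eq) (punchIn-merge y))))
    (λ h → punchIn-injective c _ _
              (trans (punchIn-merge x) (trans (Equivalence.from (redirect-≡ x y) h) (sym (punchIn-merge y)))))

does-refl : ∀ {m} (x : Fin m) → does (x ≟F x) ≡ true
does-refl x with x ≟F x
... | yes _   = refl
... | no  x≢x = contradiction refl x≢x

does-injective : ∀ {m m′} {b : Fin m → Fin m′} → Injective _≡_ _≡_ b →
                 ∀ x y → does (b x ≟F b y) ≡ does (x ≟F y)
does-injective {b = b} inj x y with x ≟F y | b x ≟F b y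
... | yes _    | yes _   = refl
... | no  _    | no  _   = refl
... | yes refl | no  ne  = contradiction refl ne
... | no  ne   | yes eq  = contradiction (inj eq) ne

drop-loop-⇔ : ∀ {m} (d s : Bool) (a c w : Fin m) → (a ≡ c → s ≡ false) → (a ≡ w → d ≡ true) →
              ((d ∧ not (does (a ≟F w))) ∧ does (a ≟F c)) ∨ s ≡ true
                ⇔ (((d ∧ does (a ≟F c)) ∨ s ≡ true) × ¬ (a ≡ w × c ≡ w))
drop-loop-⇔ d s a c w noLoop looped with a ≟F w | a ≟F c
... | yes a≡w | yes a≡c rewrite looped a≡w | noLoop a≡c =
  mk⇔ (λ ()) (λ (_ , ¬ww) → contradiction (a≡w , trans (sym a≡c) a≡w) ¬ww)
... | yes a≡w | no  a≢c rewrite looped a≡w =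
  mk⇔ (λ h → h , λ (_ , c≡w) → a≢c (trans a≡w (sym c≡w))) proj₁
... | no  a≢w | _ with d
...   | true  = mk⇔ (λ h → h , a≢w ∘ proj₁) proj₁
...   | false = mk⇔ (λ h → h , a≢w ∘ proj₁) proj₁

module Collapse (S : Digraph) (S-loopless : ∀ p → arc S p p ≡ false) where

  infixr 5 _◅_
  _◅_ : ∀ {G G′} → MRStep G G′ → MRMinor G′ S → MRMinor G S
  s ◅ (G″ , steps , iso) = G″ , s ∷ steps , iso

  record LoopedCopy (G : Digraph) : Set where
    field
      label           : Fin (n G) → Fin (n S)
      label-injective : Injective _≡_ _≡_ label
      label-surjective : StrictlySurjective _≡_ label
      looped          : Fin (n G) → Bool
      arc-label       : ∀ x y → arc G x y ≡ (looped x ∧ does (x ≟F y)) ∨ arc S (label x) (label y)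

  unlooped-≅ : ∀ {G} (L : LoopedCopy G) → (∀ x → LoopedCopy.looped L x ≡ false) → G ≅ S
  unlooped-≅ L unlooped =
    ⤖⇒↔ (mk⤖ (label-injective , strictlySurjective⇒surjective label-surjective)) ,
    λ x y → sym (trans (arc-label x y)
                       (cong (λ d → (d ∧ does (x ≟F y)) ∨ arc S (label x) (label y)) (unlooped x)))
    where open LoopedCopy L

  delete-loop : ∀ {G} (L : LoopedCopy G) (w : Fin (n G)) → LoopedCopy.looped L w ≡ true →
                Σ[ A ∈ (Fin (n G) → Fin (n G) → Bool) ] Σ[ L′ ∈ LoopedCopy (digraph (n G) A) ]
                  (MRStep G (digraph (n G) A) ×
                   (∀ x → LoopedCopy.looped L′ x ≡ true → LoopedCopy.looped L x ≡ true × x ≢ w))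
  delete-loop {G} L w looped-w = _ , L′ , deleteLoop w loop-w refl arcs⇔ , still-looped
    where
    open LoopedCopy L
    looped′ : Fin (n G) → Bool
    looped′ x = looped x ∧ not (does (x ≟F w))
    G′ : Digraph
    G′ = digraph (n G) λ x y → (looped′ x ∧ does (x ≟F y)) ∨ arc S (label x) (label y)
    L′ : LoopedCopy G′
    L′ = record { LoopedCopy L ; looped = looped′ ; arc-label = λ _ _ → refl }
    loop-w : E G w w
    loop-w = trans (arc-label w w)
      (cong₂ (λ d e → (d ∧ e) ∨ arc S (label w) (label w)) looped-w (does-refl w))
    arcs⇔ : ∀ a c → E G′ a c ⇔
                      (E G (cast refl a) (cast refl c) × ¬ (cast refl a ≡ w × cast refl c ≡ w))
    arcs⇔ a c rewrite cast-is-id refl a | cast-is-id refl c | arc-label a c =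
      drop-loop-⇔ (looped a) (arc S (label a) (label c)) a c w
        (λ { refl → S-loopless (label a) }) (λ { refl → looped-w })
    still-looped : ∀ x → looped′ x ≡ true → looped x ≡ true × x ≢ w
    still-looped x h with looped x | x ≟F w
    ... | true | no x≢w = refl , x≢w

  loops-below⇒MRMinor : ∀ j {G} (L : LoopedCopy G) →
                         (∀ x → LoopedCopy.looped L x ≡ true → toℕ x < j) → MRMinor G S
  loops-below⇒MRMinor zero {G} L below = G , done , unlooped-≅ L unlooped
    where
    unlooped : ∀ x → LoopedCopy.looped L x ≡ false
    unlooped x with LoopedCopy.looped L x in eq
    ... | false = refl
    ... | true  with below x eq
    ...   | ()
  loops-below⇒MRMinor (suc j) L below
    with any? (λ x → (toℕ x ≟ℕ j) ×-dec (LoopedCopy.looped L x ≟B true))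
  ... | yes (w , w≡j , looped-w) with delete-loop L w looped-w
  ...   | G′ , L′ , s , still-looped = s ◅ loops-below⇒MRMinor j L′ below′
    where
    below′ : ∀ x → LoopedCopy.looped L′ x ≡ true → toℕ x < j
    below′ x h with still-looped x h
    ... | looped-x , x≢w =
      ≤∧≢⇒< (≤-pred (below x looped-x)) (λ x≡j → x≢w (toℕ-injective (trans x≡j (sym w≡j))))
  loops-below⇒MRMinor (suc j) L below | no ¬looped-j = loops-below⇒MRMinor j L below′
    where
    below′ : ∀ x → LoopedCopy.looped L x ≡ true → toℕ x < j
    below′ x h = ≤∧≢⇒< (≤-pred (below x h)) (λ x≡j → ¬looped-j (x , x≡j , h))

  refl-arc : Fin (n S) → Fin (n S) → Bool
  refl-arc p q = does (p ≟F q) ∨ arc S p q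

  refl-arc-≡ : ∀ {p q} → p ≡ q → refl-arc p q ≡ true
  refl-arc-≡ {p} refl = cong (_∨ arc S p p) (does-refl p)

  -- S with every vertex blown up into a complete looped digraph.
  record Inflation (G : Digraph) : Set where
    field
      label            : Fin (n G) → Fin (n S)
      label-surjective : StrictlySurjective _≡_ label
      arc-label        : ∀ x y → arc G x y ≡ refl-arc (label x) (label y)

  injective-inflation : ∀ {G} (I : Inflation G) → Injective _≡_ _≡_ (Inflation.label I) →
                        LoopedCopy G
  injective-inflation I inj = record
    { label = label ; label-injective = inj ; label-surjective = label-surjective
    ; looped = λ _ → true
    ; arc-label = λ x y → trans (arc-label x y)
                                (cong (_∨ arc S (label x) (label y)) (does-injective inj x y)) }
    where open Inflation I

  contract-twins : ∀ {m A} (I : Inflation (digraph (suc m) A)) {a c} → a ≢ c →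
                   Inflation.label I a ≡ Inflation.label I c →
                   Σ[ A′ ∈ (Fin m → Fin m → Bool) ]
                     (MRStep (digraph (suc m) A) (digraph m A′) × Inflation (digraph m A′))
  contract-twins {m} {A} I {a} {c} a≢c twins =
    A′ , contract a c (trans (arc-label a c) (refl-arc-≡ twins)) a≢c merge
           (λ p → punchIn c p , merge-punchIn p) merge-≡ arcs⇔ ,
    record { label = label′ ; arc-label = λ _ _ → refl
           ; label-surjective = λ i → merge (proj₁ (label-surjective i)) ,
                                      trans (label-merge _) (proj₂ (label-surjective i)) }
    where
    open Inflation I
    open Merge a≢c
    label′ : Fin m → Fin (n S)
    label′ p = label (punchIn c p)
    A′ : Fin m → Fin m → Bool
    A′ p q = refl-arc (label′ p) (label′ q)
    label-redirect : ∀ x → label (redirect x) ≡ label x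
    label-redirect x with x ≟F c
    ... | yes refl = twins
    ... | no  _    = refl
    label-merge : ∀ x → label′ (merge x) ≡ label x
    label-merge x = trans (cong label (punchIn-merge x)) (label-redirect x)
    arcs⇔ : ∀ p q → E (digraph m A′) p q ⇔
                      (∃[ x ] ∃[ y ] (merge x ≡ p × merge y ≡ q ×
                                      E (digraph (suc m) A) x y × ¬ (x ≡ a × y ≡ c)))
    arcs⇔ p q = mk⇔
      (λ h → punchIn c p , punchIn c q , merge-punchIn p , merge-punchIn q , trans (arc-label _ _) h ,
             λ (_ , e) → punchInᵢ≢i c q e)
      (λ { (x , y , refl , refl , e , _) →
             subst₂ (λ u v → refl-arc u v ≡ true) (sym (label-merge x)) (sym (label-merge y))
                    (trans (sym (arc-label x y)) e) })

  inflation⇒MRMinor : ∀ m {A} → Inflation (digraph m A) → MRMinor (digraph m A) S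
  inflation⇒MRMinor m I
    with any? (λ a → any? (λ c → ¬? (a ≟F c) ×-dec (Inflation.label I a ≟F Inflation.label I c)))
  ... | no ¬twins = loops-below⇒MRMinor m (injective-inflation I injective) (λ x _ → toℕ<n x)
    where
    injective : Injective _≡_ _≡_ (Inflation.label I)
    injective {x} {y} eq with x ≟F y
    ... | yes x≡y = x≡y
    ... | no  x≢y = contradiction (x , y , x≢y , eq) ¬twins
  inflation⇒MRMinor zero    I | yes (() , _)
  inflation⇒MRMinor (suc m) I | yes (a , c , a≢c , twins) with contract-twins I a≢c twins
  ... | _ , s , I′ = s ◅ inflation⇒MRMinor m I′

directedSplit-loopless : ∀ {k ℓ} (F : UGraph k ℓ) p → arc (directedSplit F) p p ≡ false
directedSplit-loopless {k} F p with splitAt k p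
... | inj₁ _ = refl
... | inj₂ _ = refl

module Construction {k ℓ} (F : UGraph k ℓ) (H : Digraph) (f : Fin (k + ℓ) → Fin (n H))
  (f-distinct : ∀ i j → SameSCC H (f i) (f j) → i ≡ j) (f-source : ∀ i → SourceSCC H (f i)) where
  open Collapse (directedSplit F) (directedSplit-loopless F)
  open Walks H using (SameSCC?)

  classify : Fin (n H) → Maybe (Fin (k + ℓ))
  classify x with any? (λ i → SameSCC? x (f i))
  ... | yes (i , _) = just i
  ... | no  _       = nothing

  Classified : Fin (n H) → Maybe (Fin (k + ℓ)) → Set
  Classified x (just i) = SameSCC H x (f i)
  Classified x nothing  = ∀ i → ¬ SameSCC H x (f i)

  classify-correct : ∀ x → Classified x (classify x)
  classify-correct x with any? (λ i → SameSCC? x (f i))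
  ... | yes (_ , s) = s
  ... | no  ¬s      = λ i s → ¬s (i , s)

  classify-f : ∀ i → classify (f i) ≡ just i
  classify-f i = from-correct (classify (f i)) (classify-correct (f i))
    where
    from-correct : ∀ m → Classified (f i) m → m ≡ just i
    from-correct (just j) s  = cong just (sym (f-distinct i j s))
    from-correct nothing  ¬s = contradiction (here , here) (¬s i)

  IsClassified : Fin (n H) → Set
  IsClassified x = ∃[ i ] classify x ≡ just i

  isClassified? : Decidable IsClassified
  isClassified? x with classify x
  ... | just i  = yes (i , refl)
  ... | nothing = no λ { (_ , ()) }

  unclassified : ∀ x → ¬ IsClassified x → classify x ≡ nothing
  unclassified x ¬c with classify x
  ... | just i  = contradiction (i , refl) ¬c
  ... | nothing = refl

  class-arc : Maybe (Fin (k + ℓ)) → Maybe (Fin (k + ℓ)) → Bool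
  class-arc (just p) (just q) = refl-arc p q
  class-arc (just _) nothing  = true
  class-arc nothing  nothing  = true
  class-arc nothing  (just _) = false

  class-arc-⊇ : ∀ {u v} mu mv → Classified u mu → Classified v mv → E H u v → class-arc mu mv ≡ true
  class-arc-⊇ {u} {v} (just p) (just q) su sv e =
    refl-arc-≡ (f-distinct p q (Reach-trans (proj₂ su) (proj₁ su′) ,
                                Reach-trans (proj₂ su′) (proj₁ su)))
    where
    su′ : SameSCC H u (f q)
    su′ = f-source q u v e sv
  class-arc-⊇ (just _) nothing  _  _  _ = refl
  class-arc-⊇ nothing  nothing  _  _  _ = refl
  class-arc-⊇ {u} {v} nothing (just q) ¬su sv e = contradiction (f-source q u v e sv) (¬su q)

  H′ : ArcSupergraph H
  H′ = record
    { arc′     = λ u v → class-arc (classify u) (classify v)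
    ; superset = λ u v → class-arc-⊇ (classify u) (classify v) (classify-correct u) (classify-correct v) }

  open ArcSupergraph H′ using (graph)

  class-arc-nothing : ∀ m → class-arc nothing m ≡ true → m ≡ nothing
  class-arc-nothing nothing  _ = refl
  class-arc-nothing (just _) ()

  unclassified-closed : ∀ {x y} → classify x ≡ nothing → Reach graph x y → classify y ≡ nothing
  unclassified-closed cx here = cx
  unclassified-closed {x} cx (step {w = w} e r) =
    unclassified-closed
      (class-arc-nothing (classify w) (subst (λ m → class-arc m (classify w) ≡ true) cx e)) r

  unclassified-SameSCC : ∀ {x y} → classify x ≡ nothing → classify y ≡ nothing → SameSCC graph x y
  unclassified-SameSCC cx cy = step (arc-nothing cx cy) here , step (arc-nothing cy cx) here
    where
    arc-nothing : ∀ {x y} → classify x ≡ nothing → classify y ≡ nothing → E graph x y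
    arc-nothing cx cy = subst₂ (λ a b → class-arc a b ≡ true) (sym cx) (sym cy) refl

  classified-inflation : ∀ {m} (ι : Fin m → Fin (n H)) → (∀ z → IsClassified (ι z)) →
                         (∀ u → IsClassified u → ∃[ z ] ι z ≡ u) →
                         Inflation (digraph m λ z w → arc graph (ι z) (ι w))
  classified-inflation ι sound complete = record
    { label = label ; label-surjective = label-surjective
    ; arc-label = λ z w → subst₂ (λ a b → class-arc a b ≡ refl-arc (label z) (label w))
                                 (sym (proj₂ (sound z))) (sym (proj₂ (sound w))) refl }
    where
    label : _ → Fin (k + ℓ)
    label z = proj₁ (sound z)
    label-surjective : ∀ i → ∃[ z ] label z ≡ i
    label-surjective i with complete (f i) (i , classify-f i)
    ... | z , ιz≡fi =
      z , just-injective (trans (sym (proj₂ (sound z))) (trans (cong classify ιz≡fi) (classify-f i)))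

  minor : MRMinor graph (directedSplit F)
  minor with all? isClassified?
  ... | yes classified = inflation⇒MRMinor (n H) (classified-inflation id classified (λ u _ → u , refl))
  ... | no ¬classified =
    deleteSink r sink index index-injective outside inside (λ _ _ → refl) ◅
    inflation⇒MRMinor size (classified-inflation index index-sound index-complete)
    where
    open Enumeration (enumerate isClassified?)
    r = proj₁ (¬∀⟶∃¬ _ IsClassified isClassified? ¬classified)
    r-unclassified : classify r ≡ nothing
    r-unclassified = unclassified r (proj₂ (¬∀⟶∃¬ _ IsClassified isClassified? ¬classified))
    sink : SinkSCC graph r
    sink u w e (_ , r→u) = unclassified-SameSCC
      (unclassified-closed r-unclassified (Reach-trans r→u (step e here))) r-unclassified
    outside : ∀ z → ¬ SameSCC graph (index z) r
    outside z (_ , r→ιz) with trans (sym (unclassified-closed r-unclassified r→ιz)) (proj₂ (index-sound z))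
    ... | ()
    inside : ∀ u → ¬ SameSCC graph u r → ∃[ z ] index z ≡ u
    inside u ¬same with isClassified? u
    ... | yes c  = index-complete u c
    ... | no  ¬c = contradiction (unclassified-SameSCC (unclassified u ¬c) r-unclassified) ¬same

lemma37 : ∀ {k ℓ} (F : UGraph k ℓ) (H : Digraph) → αs≥ H (k + ℓ) →
    Σ (ArcSupergraph H) λ H′ → MRMinor (ArcSupergraph.graph H′) (directedSplit F)
lemma37 F H (f , distinct , sources) = H′ , minor
  where open Construction F H f distinct sources
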